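{- Let $(\alpha,\beta)\in\overline{P}$ and let $\omega$ be a finite or (right-)infinite word over $\{a,b\}$. If $\omega=\gamma_1\gamma_2\cdots\gamma_n=\eta_1\eta_2\cdots\eta_m$ with all $\gamma_i,\eta_j\in\{\alpha,\beta\}$ and $n,m\in\mathbb{N}\cup\{\infty\}$, then $n=m$ and $\gamma_i=\eta_i$ for all $i$.
   Context: $\overline{U},\overline{V}$ act on pairs of words over $\{a,b\}$ by $\overline{U}(\alpha,\beta)=(\alpha\beta,\beta)$ and $\overline{V}(\alpha,\beta)=(\alpha,\alpha\beta)$. $\overline{P}$ is the set of all pairs obtained from $(a,b)$ by applying finitely many (possibly zero) of the operators $\overline{U},\overline{V}$. -}

module Defs where

open import Data.Nat using (ℕ; zero; suc; _<_)
open import Data.List using (List; []; _∷_; _++_; length; lookup)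
open import Data.Fin using (fromℕ<)
open import Data.Product using (_×_; _,_; ∃)
open import Relation.Binary.PropositionalEquality using (_≡_)

data Letter : Set where
  a b : Letter

Word : Set
Word = List Letter

InfWord : Set
InfWord = ℕ → Letter

Ū : Word × Word → Word × Word
Ū (α , β) = (α ++ β , β)

V̄ : Word × Word → Word × Word
V̄ (α , β) = (α , α ++ β)

data InP̄ : Word × Word → Set where
  base : InP̄ (a ∷ [] , b ∷ [])
  stepU : ∀ {p} → InP̄ p → InP̄ (Ū p)
  stepV : ∀ {p} → InP̄ p → InP̄ (V̄ p)

concatUpTo : (ℕ → Word) → ℕ → Word
concatUpTo γ zero = []
concatUpTo γ (suc k) = concatUpTo γ k ++ γ k

IsPrefixOf : Word → InfWord → Set
IsPrefixOf w ω = ∀ i (p : i < length w) → lookup w (fromℕ< p) ≡ ω i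

-- ω = γ 0 γ 1 γ 2 ⋯ (infinite product): every finite partial product is a prefix
-- of ω, and the partial products exhaust all positions of ω
InfProduct : (ℕ → Word) → InfWord → Set
InfProduct γ ω = (∀ k → IsPrefixOf (concatUpTo γ k) ω)
               × (∀ i → ∃ λ k → i < length (concatUpTo γ k))

-- Every pair of P̄ is (μ a, μ b) for a morphism μ in the monoid generated by
-- σU : a ↦ ab, b ↦ b and σV : a ↦ a, b ↦ ab, because Ū and V̄ commute with
-- applying a morphism to both components. Factorizations over {α, β} are then
-- μ-images of factorizations over {a, b}, which are trivially unique, and
-- uniqueness survives each generator: it is injective, and comparable images
-- of two words, each extended by a non-empty word, force the two words to be
-- comparable. For infinite words, comparability of all partial products is
-- exactly what two factorizations of the same word have in common.
module Submission where

open import Defs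
open import Data.Nat using (ℕ; zero; suc; s≤s; z≤n)
open import Data.List using (List; []; _∷_; _++_; concat; concatMap; map)
open import Data.List.Properties using (∷-injective; ++-conicalˡ; ++-conicalʳ; ++-cancelˡ; concatMap-++)
open import Data.List.Relation.Binary.Prefix.Heterogeneous using (Prefix; []; _∷_; head)
open import Data.List.Relation.Binary.Prefix.Heterogeneous.Properties using (++⁻; fromPointwise)
import Data.List.Relation.Binary.Pointwise.Properties as Pointwise
open import Data.List.Relation.Unary.All as All using (All; []; _∷_)
open import Data.Product using (_×_; _,_; ∃; proj₁; proj₂)
open import Data.Sum as Sum using (_⊎_; inj₁; inj₂)
open import Data.Empty using (⊥-elim)
open import Function.Definitions using (Injective)
open import Relation.Binary.PropositionalEquality

module _ {A : Set} where

  _≼_ : List A → List A → Set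
  _≼_ = Prefix _≡_

  ≼-refl : ∀ {u} → u ≼ u
  ≼-refl = fromPointwise (Pointwise.refl refl)

  Comparable : List A → List A → Set
  Comparable u v = u ≼ v ⊎ v ≼ u

  comparable-head : ∀ {x y s t} → Comparable (x ∷ s) (y ∷ t) → x ≡ y
  comparable-head (inj₁ p) = head p
  comparable-head (inj₂ p) = sym (head p)

  comparable-∷ : ∀ x {s t} → Comparable s t → Comparable (x ∷ s) (x ∷ t)
  comparable-∷ x = Sum.map (refl ∷_) (refl ∷_)

  comparable-++⁻ : ∀ p {s t} → Comparable (p ++ s) (p ++ t) → Comparable s t
  comparable-++⁻ p = Sum.map (++⁻ refl) (++⁻ refl)

  ++-nonempty : ∀ u {z : List A} → z ≢ [] → u ++ z ≢ []
  ++-nonempty u z≢[] e = z≢[] (++-conicalʳ u _ e)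

prefixes-comparable : ∀ u v {ω} → IsPrefixOf u ω → IsPrefixOf v ω → Comparable u v
prefixes-comparable []      v       _    _    = inj₁ []
prefixes-comparable (_ ∷ _) []      _    _    = inj₂ []
prefixes-comparable (x ∷ u) (y ∷ v) u≼ω v≼ω
  with refl ← trans (u≼ω 0 (s≤s z≤n)) (sym (v≼ω 0 (s≤s z≤n))) =
  comparable-∷ x (prefixes-comparable u v (λ i p → u≼ω (suc i) (s≤s p)) (λ i p → v≼ω (suc i) (s≤s p)))

OneOf : Word → Word → Word → Set
OneOf α β γ = γ ≡ α ⊎ γ ≡ β

oneOf-nonempty : ∀ {α β γ} → α ≢ [] → β ≢ [] → OneOf α β γ → γ ≢ []
oneOf-nonempty α≢[] β≢[] (inj₁ refl) = α≢[]
oneOf-nonempty α≢[] β≢[] (inj₂ refl) = β≢[]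

UniquelyDecipherable : Word → Word → Set
UniquelyDecipherable α β = (γs ηs : List Word) → All (OneOf α β) γs → All (OneOf α β) ηs →
  concat γs ≡ concat ηs → γs ≡ ηs

ωUniquelyDecipherable : Word → Word → Set
ωUniquelyDecipherable α β = (γ η : ℕ → Word) → (∀ i → OneOf α β (γ i)) → (∀ i → OneOf α β (η i)) →
  (∀ k k′ → Comparable (concatUpTo γ k) (concatUpTo η k′)) → ∀ i → γ i ≡ η i

module LetterMorphism (σ : Letter → Word) where

  μ : Word → Word
  μ = concatMap σ

  NonErasing : Set
  NonErasing = ∀ x → σ x ≢ []

  -- The tails must be non-empty: σV a = a is a prefix of σV b = ab.
  ReflectsFirstLetter : Set
  ReflectsFirstLetter = ∀ {x y s t} → s ≢ [] → t ≢ [] → Comparable (μ (x ∷ s)) (μ (y ∷ t)) → x ≡ y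

  μ-conical : NonErasing → ∀ w → μ w ≡ [] → w ≡ []
  μ-conical nonErasing []      _ = refl
  μ-conical nonErasing (x ∷ w) e = ⊥-elim (nonErasing x (++-conicalˡ (σ x) (μ w) e))

  μ-nonempty : NonErasing → ∀ {w} → w ≢ [] → μ w ≢ []
  μ-nonempty nonErasing {w} w≢[] e = w≢[] (μ-conical nonErasing w e)

  comparable-reflect : ReflectsFirstLetter → ∀ u v {z z′} → z ≢ [] → z′ ≢ [] →
    Comparable (μ (u ++ z)) (μ (v ++ z′)) → Comparable u v
  comparable-reflect reflects []      v       _    _     _ = inj₁ []
  comparable-reflect reflects (_ ∷ _) []      _    _     _ = inj₂ []
  comparable-reflect reflects (x ∷ u) (y ∷ v) z≢[] z′≢[] c
    with refl ← reflects (++-nonempty u z≢[]) (++-nonempty v z′≢[]) c =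
    comparable-∷ x (comparable-reflect reflects u v z≢[] z′≢[] (comparable-++⁻ (σ x) c))

  prefix-injective : NonErasing → ∀ {u v} → u ≼ v → μ u ≡ μ v → u ≡ v
  prefix-injective nonErasing []               e = sym (μ-conical nonErasing _ (sym e))
  prefix-injective nonErasing (_∷_ {a = x} refl p) e =
    cong (x ∷_) (prefix-injective nonErasing p (++-cancelˡ (σ x) _ _ e))

  -- Appending a letter turns u and v into non-empty extensions with equal images.
  injective : NonErasing → ReflectsFirstLetter → Injective _≡_ _≡_ μ
  injective nonErasing reflects {u} {v} μu≡μv = from-comparable u~v
    where
    open ≡-Reasoning
    μua≡μva : μ (u ++ a ∷ []) ≡ μ (v ++ a ∷ [])
    μua≡μva = begin
      μ (u ++ a ∷ [])     ≡⟨ concatMap-++ σ u (a ∷ []) ⟩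
      μ u ++ μ (a ∷ [])   ≡⟨ cong (_++ μ (a ∷ [])) μu≡μv ⟩
      μ v ++ μ (a ∷ [])   ≡⟨ concatMap-++ σ v (a ∷ []) ⟨
      μ (v ++ a ∷ [])     ∎
    u~v : Comparable u v
    u~v = comparable-reflect reflects u v (λ ()) (λ ()) (inj₁ (subst (μ (u ++ a ∷ []) ≼_) μua≡μva ≼-refl))
    from-comparable : Comparable u v → u ≡ v
    from-comparable (inj₁ u≼v) = prefix-injective nonErasing u≼v μu≡μv
    from-comparable (inj₂ v≼u) = sym (prefix-injective nonErasing v≼u (sym μu≡μv))

  concat-map-μ : ∀ ws → concat (map μ ws) ≡ μ (concat ws)
  concat-map-μ []       = refl
  concat-map-μ (w ∷ ws) = trans (cong (μ w ++_) (concat-map-μ ws)) (sym (concatMap-++ σ w (concat ws)))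

  concatUpTo-μ : ∀ {γ δ} → (∀ i → γ i ≡ μ (δ i)) → ∀ k → concatUpTo γ k ≡ μ (concatUpTo δ k)
  concatUpTo-μ γ≡μδ zero    = refl
  concatUpTo-μ {δ = δ} γ≡μδ (suc k) =
    trans (cong₂ _++_ (concatUpTo-μ γ≡μδ k) (γ≡μδ k)) (sym (concatMap-++ σ (concatUpTo δ k) (δ k)))

  module _ {α β : Word} where

    decode : ∀ {γ} → OneOf (μ α) (μ β) γ → ∃ λ δ → OneOf α β δ × γ ≡ μ δ
    decode (inj₁ refl) = α , inj₁ refl , refl
    decode (inj₂ refl) = β , inj₂ refl , refl

    decode-All : ∀ {γs} → All (OneOf (μ α) (μ β)) γs → ∃ λ δs → All (OneOf α β) δs × γs ≡ map μ δs
    decode-All []         = [] , [] , refl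
    decode-All (γ∈ ∷ γs∈) with δ , δ∈ , refl ← decode γ∈ | δs , δs∈ , refl ← decode-All γs∈ =
      δ ∷ δs , δ∈ ∷ δs∈ , refl

    image-uniquelyDecipherable : NonErasing → ReflectsFirstLetter →
      UniquelyDecipherable α β → UniquelyDecipherable (μ α) (μ β)
    image-uniquelyDecipherable nonErasing reflects ud γs ηs γs∈ ηs∈ eq
      with δs , δs∈ , refl ← decode-All γs∈ | εs , εs∈ , refl ← decode-All ηs∈ =
      cong (map μ) (ud δs εs δs∈ εs∈ (injective nonErasing reflects
        (trans (sym (concat-map-μ δs)) (trans eq (concat-map-μ εs)))))

    image-ωUniquelyDecipherable : ReflectsFirstLetter → α ≢ [] → β ≢ [] →
      ωUniquelyDecipherable α β → ωUniquelyDecipherable (μ α) (μ β)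
    image-ωUniquelyDecipherable reflects α≢[] β≢[] ωud γ η γ∈ η∈ comparable i =
      trans (γ≡μδ i) (trans (cong μ (ωud δ ε δ∈ ε∈ decoded-comparable i)) (sym (η≡με i)))
      where
      δ ε : ℕ → Word
      δ i = proj₁ (decode (γ∈ i))
      ε i = proj₁ (decode (η∈ i))
      δ∈ : ∀ i → OneOf α β (δ i)
      δ∈ i = proj₁ (proj₂ (decode (γ∈ i)))
      ε∈ : ∀ i → OneOf α β (ε i)
      ε∈ i = proj₁ (proj₂ (decode (η∈ i)))
      γ≡μδ : ∀ i → γ i ≡ μ (δ i)
      γ≡μδ i = proj₂ (proj₂ (decode (γ∈ i)))
      η≡με : ∀ i → η i ≡ μ (ε i)
      η≡με i = proj₂ (proj₂ (decode (η∈ i)))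
      decoded-comparable : ∀ k k′ → Comparable (concatUpTo δ k) (concatUpTo ε k′)
      decoded-comparable k k′ =
        comparable-reflect reflects (concatUpTo δ k) (concatUpTo ε k′)
          (oneOf-nonempty α≢[] β≢[] (δ∈ k)) (oneOf-nonempty α≢[] β≢[] (ε∈ k′))
          (subst₂ Comparable (concatUpTo-μ γ≡μδ (suc k)) (concatUpTo-μ η≡με (suc k′))
            (comparable (suc k) (suc k′)))

IsSingleton : Word → Set
IsSingleton w = ∃ λ x → w ≡ x ∷ []

concat-singletons-injective : ∀ {γs ηs} → All IsSingleton γs → All IsSingleton ηs →
  concat γs ≡ concat ηs → γs ≡ ηs
concat-singletons-injective []                 []                 _  = refl
concat-singletons-injective []                 ((_ , refl) ∷ _)   ()
concat-singletons-injective ((_ , refl) ∷ _)   []                 ()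
concat-singletons-injective ((x , refl) ∷ γs₁) ((_ , refl) ∷ ηs₁) eq
  with refl , eq′ ← ∷-injective eq = cong ((x ∷ []) ∷_) (concat-singletons-injective γs₁ ηs₁ eq′)

comparable-singletons : ∀ {u v} → IsSingleton u → IsSingleton v → Comparable u v → u ≡ v
comparable-singletons (_ , refl) (_ , refl) c = cong (_∷ []) (comparable-head c)

oneOf-ab-singleton : ∀ {γ} → OneOf (a ∷ []) (b ∷ []) γ → IsSingleton γ
oneOf-ab-singleton (inj₁ refl) = a , refl
oneOf-ab-singleton (inj₂ refl) = b , refl

ab-uniquelyDecipherable : UniquelyDecipherable (a ∷ []) (b ∷ [])
ab-uniquelyDecipherable _ _ γs∈ ηs∈ =
  concat-singletons-injective (All.map oneOf-ab-singleton γs∈) (All.map oneOf-ab-singleton ηs∈)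

ab-ωUniquelyDecipherable : ωUniquelyDecipherable (a ∷ []) (b ∷ [])
ab-ωUniquelyDecipherable γ η γ∈ η∈ comparable i = equal-at i (equal-upTo i)
  where
  equal-at : ∀ k → concatUpTo γ k ≡ concatUpTo η k → γ k ≡ η k
  equal-at k e =
    comparable-singletons (oneOf-ab-singleton (γ∈ k)) (oneOf-ab-singleton (η∈ k))
      (comparable-++⁻ (concatUpTo η k)
        (subst (λ w → Comparable (w ++ γ k) (concatUpTo η k ++ η k)) e (comparable (suc k) (suc k))))
  equal-upTo : ∀ k → concatUpTo γ k ≡ concatUpTo η k
  equal-upTo zero    = refl
  equal-upTo (suc k) = cong₂ _++_ (equal-upTo k) (equal-at k (equal-upTo k))

σU σV : Letter → Word
σU a = a ∷ b ∷ []
σU b = b ∷ []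
σV a = a ∷ []
σV b = a ∷ b ∷ []

data Generator : (Letter → Word) → Set where
  U : Generator σU
  V : Generator σV

generator-nonErasing : ∀ {σ} → Generator σ → LetterMorphism.NonErasing σ
generator-nonErasing U a ()
generator-nonErasing U b ()
generator-nonErasing V a ()
generator-nonErasing V b ()

generator-reflectsFirstLetter : ∀ {σ} → Generator σ → LetterMorphism.ReflectsFirstLetter σ
generator-reflectsFirstLetter U {a} {a} _ _ _ = refl
generator-reflectsFirstLetter U {b} {b} _ _ _ = refl
generator-reflectsFirstLetter U {a} {b} _ _ c with () ← comparable-head c
generator-reflectsFirstLetter U {b} {a} _ _ c with () ← comparable-head c
generator-reflectsFirstLetter V {a} {a} _ _ _ = refl
generator-reflectsFirstLetter V {b} {b} _ _ _ = refl
generator-reflectsFirstLetter V {a} {b} {[]}    s≢[] _ _ = ⊥-elim (s≢[] refl)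
generator-reflectsFirstLetter V {a} {b} {a ∷ _} _ _ c with () ← comparable-head (comparable-++⁻ (a ∷ []) c)
generator-reflectsFirstLetter V {a} {b} {b ∷ _} _ _ c with () ← comparable-head (comparable-++⁻ (a ∷ []) c)
generator-reflectsFirstLetter V {b} {a} {t = []}    _ t≢[] _ = ⊥-elim (t≢[] refl)
generator-reflectsFirstLetter V {b} {a} {t = a ∷ _} _ _ c with () ← comparable-head (comparable-++⁻ (a ∷ []) c)
generator-reflectsFirstLetter V {b} {a} {t = b ∷ _} _ _ c with () ← comparable-head (comparable-++⁻ (a ∷ []) c)

data InP̄ᵐ : Word × Word → Set where
  ab    : InP̄ᵐ (a ∷ [] , b ∷ [])
  image : ∀ {σ α β} → Generator σ → InP̄ᵐ (α , β) → InP̄ᵐ (concatMap σ α , concatMap σ β)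

Ū-closed : ∀ {p} → InP̄ᵐ p → InP̄ᵐ (Ū p)
Ū-closed ab = image U ab
Ū-closed (image {σ} {α} {β} g q) =
  subst (λ w → InP̄ᵐ (w , concatMap σ β)) (concatMap-++ σ α β) (image g (Ū-closed q))

V̄-closed : ∀ {p} → InP̄ᵐ p → InP̄ᵐ (V̄ p)
V̄-closed ab = image V ab
V̄-closed (image {σ} {α} {β} g q) =
  subst (λ w → InP̄ᵐ (concatMap σ α , w)) (concatMap-++ σ α β) (image g (V̄-closed q))

InP̄⇒InP̄ᵐ : ∀ {p} → InP̄ p → InP̄ᵐ p
InP̄⇒InP̄ᵐ base      = ab
InP̄⇒InP̄ᵐ (stepU q) = Ū-closed (InP̄⇒InP̄ᵐ q)
InP̄⇒InP̄ᵐ (stepV q) = V̄-closed (InP̄⇒InP̄ᵐ q)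

InP̄ᵐ-nonempty : ∀ {α β} → InP̄ᵐ (α , β) → α ≢ [] × β ≢ []
InP̄ᵐ-nonempty ab = (λ ()) , (λ ())
InP̄ᵐ-nonempty (image {σ} g q) =
  let α≢[] , β≢[] = InP̄ᵐ-nonempty q
      open LetterMorphism σ
  in μ-nonempty (generator-nonErasing g) α≢[] , μ-nonempty (generator-nonErasing g) β≢[]

InP̄ᵐ-uniquelyDecipherable : ∀ {α β} → InP̄ᵐ (α , β) → UniquelyDecipherable α β
InP̄ᵐ-uniquelyDecipherable ab = ab-uniquelyDecipherable
InP̄ᵐ-uniquelyDecipherable (image {σ} g q) =
  LetterMorphism.image-uniquelyDecipherable σ (generator-nonErasing g) (generator-reflectsFirstLetter g)
    (InP̄ᵐ-uniquelyDecipherable q)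

InP̄ᵐ-ωUniquelyDecipherable : ∀ {α β} → InP̄ᵐ (α , β) → ωUniquelyDecipherable α β
InP̄ᵐ-ωUniquelyDecipherable ab = ab-ωUniquelyDecipherable
InP̄ᵐ-ωUniquelyDecipherable (image {σ} g q) =
  let α≢[] , β≢[] = InP̄ᵐ-nonempty q
  in LetterMorphism.image-ωUniquelyDecipherable σ (generator-reflectsFirstLetter g) α≢[] β≢[]
       (InP̄ᵐ-ωUniquelyDecipherable q)

proposition2p8 : (α β : Word) → InP̄ (α , β) →
    ((γs ηs : List Word) →
      All (λ γ → γ ≡ α ⊎ γ ≡ β) γs →
      All (λ η → η ≡ α ⊎ η ≡ β) ηs →
      concat γs ≡ concat ηs → γs ≡ ηs)
    × ((ω : InfWord) (γ η : ℕ → Word) →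
      (∀ i → γ i ≡ α ⊎ γ i ≡ β) →
      (∀ i → η i ≡ α ⊎ η i ≡ β) →
      InfProduct γ ω → InfProduct η ω → ∀ i → γ i ≡ η i)
proposition2p8 α β αβ∈P̄ =
  InP̄ᵐ-uniquelyDecipherable αβ∈P̄ᵐ ,
  λ ω γ η γ∈ η∈ (γ≼ω , _) (η≼ω , _) →
    InP̄ᵐ-ωUniquelyDecipherable αβ∈P̄ᵐ γ η γ∈ η∈
      (λ k k′ → prefixes-comparable (concatUpTo γ k) (concatUpTo η k′) (γ≼ω k) (η≼ω k′))
  where
  αβ∈P̄ᵐ : InP̄ᵐ (α , β)
  αβ∈P̄ᵐ = InP̄⇒InP̄ᵐ αβ∈P̄
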